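{- Let $G$ be the complete multipartite graph $K_{n_1,\ldots,n_k}$, where $k\ge 2$ and $n_i\ge 2$ for all $i\in\{1,\ldots,k\}$. Then A wins the gp achievement game on $G$ if and only if $k$ is odd and at least one $n_i$ is odd.
   Context: A general position set of a graph $G$ is a set $S\subseteq V(G)$ such that no three vertices of $S$ lie on a common shortest path of $G$. The gp achievement game on $G$: players A and B alternately select vertices of $G$, A first; a selection of a vertex is legal if it has not been selected before and the set of all vertices selected so far (including it) is a general position set of $G$. The game ends when no legal move exists, and the player who selected the last vertex wins; "a player wins the game" means that player has a winning strategy. -}

module Defs where

open import Data.Nat using (ℕ; zero; suc; _≤_; _%_)
open import Data.Fin using (Fin)
open import Data.List using (List; []; _∷_)
open import Data.List.Membership.Propositional using (_∈_; _∉_)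
open import Data.Product using (Σ; _×_; _,_; proj₁)
open import Relation.Binary.PropositionalEquality using (_≡_; _≢_)
open import Relation.Nullary using (¬_)

record Graph : Set₁ where
  field
    Vertex : Set
    Adj    : Vertex → Vertex → Set

module _ (G : Graph) where
  open Graph G

  data Walk : Vertex → Vertex → Set where
    here : (v : Vertex) → Walk v v
    step : {u w v : Vertex} → Adj u w → Walk w v → Walk u v

  walkLength : {u v : Vertex} → Walk u v → ℕ
  walkLength (here _)   = zero
  walkLength (step _ p) = suc (walkLength p)

  walkVertices : {u v : Vertex} → Walk u v → List Vertex
  walkVertices (here v)           = v ∷ []
  walkVertices (step {u} _ p)     = u ∷ walkVertices p

  IsShortest : {u v : Vertex} → Walk u v → Set
  IsShortest {u} {v} p = (q : Walk u v) → walkLength p ≤ walkLength q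

  OnCommonShortestPath : Vertex → Vertex → Vertex → Set
  OnCommonShortestPath x y z =
    Σ Vertex λ u → Σ Vertex λ v → Σ (Walk u v) λ p →
      IsShortest p × (x ∈ walkVertices p) × (y ∈ walkVertices p) × (z ∈ walkVertices p)

  IsGPSet : List Vertex → Set
  IsGPSet S = ∀ {x y z} → x ∈ S → y ∈ S → z ∈ S →
    x ≢ y → y ≢ z → x ≢ z → ¬ OnCommonShortestPath x y z

  -- the game: the state is the list of vertices selected so far
  LegalMove : List Vertex → Vertex → Set
  LegalMove s v = (v ∉ s) × IsGPSet (v ∷ s)

  -- PlayerToMoveWins s : the player to move in state s has a winning strategy
  -- PlayerToMoveLoses s : the other player has a winning strategy
  -- (the player who selects the last vertex wins; if no legal move exists the player to move loses)
  data PlayerToMoveWins (s : List Vertex) : Set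
  data PlayerToMoveLoses (s : List Vertex) : Set

  data PlayerToMoveWins s where
    move : (v : Vertex) → LegalMove s v → PlayerToMoveLoses (v ∷ s) → PlayerToMoveWins s

  data PlayerToMoveLoses s where
    allMoves : ((v : Vertex) → LegalMove s v → PlayerToMoveWins (v ∷ s)) → PlayerToMoveLoses s

  AWinsGP : Set
  AWinsGP = PlayerToMoveWins []

completeMultipartite : (k : ℕ) → (Fin k → ℕ) → Graph
completeMultipartite k n = record
  { Vertex = Σ (Fin k) (λ i → Fin (n i))
  ; Adj    = λ u v → proj₁ u ≢ proj₁ v
  }

Odd : ℕ → Set
Odd m = m % 2 ≡ 1

{-# OPTIONS --safe #-}
module Submission where

-- Any two vertices are in general position, and three distinct vertices lie on a common
-- geodesic exactly when two of them share a part and the third does not.  Hence after the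
-- first two moves the selected set must stay inside one part (if those moves share a part i)
-- or meet every part at most once (otherwise), and every play then lasts exactly n i − 2,
-- respectively k − 2, further moves, so parity decides the winner.  B may answer A's first
-- vertex either inside or outside its part, so A needs both numbers odd; conversely A wins by
-- starting in a part of odd size.

open import Defs
open import Data.Nat using (ℕ; zero; suc; _≤_; _∸_; _%_; z≤n; s≤s)
open import Data.Nat.Properties using (suc-injective; ≤-trans; 1+n≰n; n≮0) renaming (_≟_ to _≟ℕ_)
open import Data.Fin using (Fin; zero; suc)
open import Data.Fin.Properties using () renaming (_≟_ to _≟ᶠ_)
open import Data.Product using (Σ; ∃-syntax; _×_; _,_; proj₁; proj₂)
open import Data.Product.Properties using (≡-dec)
open import Data.Product.Function.NonDependent.Propositional using (_×-⇔_)
open import Data.List using (List; []; _∷_; length; map; filter; allFin)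
open import Data.List.Properties
  using (filter-accept; filter-reject; filter-all; length-map; length-tabulate)
open import Data.List.Membership.Propositional using (_∈_; _∉_)
open import Data.List.Membership.Propositional.Properties
  using (∈-map⁺; ∈-map⁻; ∈-filter⁺; ∈-filter⁻; ∈-allFin)
open import Data.List.Relation.Unary.All as All using ()
open import Data.List.Relation.Unary.Any using (here; there)
open import Data.List.Relation.Unary.Any.Properties using (¬Any[])
open import Data.List.Relation.Unary.AllPairs using (_∷_)
open import Data.List.Relation.Unary.Unique.Propositional using (Unique)
open import Data.List.Relation.Unary.Unique.Propositional.Properties using (map⁺; filter⁺; allFin⁺)
open import Data.Empty using (⊥; ⊥-elim)
open import Relation.Nullary using (¬_; Dec; yes; no)
open import Relation.Nullary.Decidable using (¬?; decidable-stable)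
open import Relation.Binary.Definitions using (DecidableEquality)
open import Relation.Binary.PropositionalEquality using (_≡_; _≢_; refl; sym; trans; cong; subst)
open import Function.Base using (id; _∘_)
open import Function.Bundles using (_⇔_; mk⇔; Equivalence)
open import Function.Properties.Equivalence using ()
  renaming (refl to ⇔-refl; sym to ⇔-sym; trans to ⇔-trans)

open Equivalence using (to; from)

Odd? : ∀ m → Dec (Odd m)
Odd? m = m % 2 ≟ℕ 1

odd-suc⇒¬odd : ∀ m → Odd (suc m) → ¬ Odd m
odd-suc⇒¬odd zero          _ ()
odd-suc⇒¬odd (suc zero)    ()
odd-suc⇒¬odd (suc (suc m)) = odd-suc⇒¬odd m

¬odd-suc⇒odd : ∀ m → ¬ Odd (suc m) → Odd m
¬odd-suc⇒odd zero          ¬odd = ⊥-elim (¬odd refl)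
¬odd-suc⇒odd (suc zero)    _    = refl
¬odd-suc⇒odd (suc (suc m)) = ¬odd-suc⇒odd m

odd-∸2⇔odd : ∀ {m} → 2 ≤ m → Odd (m ∸ 2) ⇔ Odd m
odd-∸2⇔odd (s≤s (s≤s _)) = ⇔-refl

inhabitant : ∀ {m} → 2 ≤ m → Fin m
inhabitant (s≤s _) = zero

length-allFin : ∀ m → length (allFin m) ≡ m
length-allFin m = length-tabulate id

another : ∀ {m} → 2 ≤ m → (j : Fin m) → ∃[ j′ ] j′ ≢ j
another (s≤s (s≤s _)) zero    = suc zero , λ ()
another (s≤s (s≤s _)) (suc j) = zero , λ ()

module _ {A : Set} where

  ∉-∷⇔ : ∀ {a b : A} {xs} → a ∉ b ∷ xs ⇔ (a ∉ xs × a ≢ b)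
  ∉-∷⇔ = mk⇔ (λ a∉ → a∉ ∘ there , a∉ ∘ here)
             (λ { (a∉ , a≢b) (here a≡b) → a≢b a≡b ; (a∉ , a≢b) (there a∈) → a∉ a∈ })

  module _ {x y z : A} (x≢y : x ≢ y) (y≢z : y ≢ z) (x≢z : x ≢ z) where

    distinct-∉-pair : ∀ {a b} → x ∈ a ∷ b ∷ [] → y ∈ a ∷ b ∷ [] → z ∈ a ∷ b ∷ [] → ⊥
    distinct-∉-pair (here refl)         (here refl)         _                   = x≢y refl
    distinct-∉-pair (here refl)         (there (here refl)) (here refl)         = x≢z refl
    distinct-∉-pair (here refl)         (there (here refl)) (there (here refl)) = y≢z refl
    distinct-∉-pair (there (here refl)) (here refl)         (here refl)         = y≢z refl
    distinct-∉-pair (there (here refl)) (here refl)         (there (here refl)) = x≢z refl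
    distinct-∉-pair (there (here refl)) (there (here refl)) _                   = x≢y refl

    head-∈-distinct : ∀ {a b c} → x ∈ a ∷ b ∷ c ∷ [] → y ∈ a ∷ b ∷ c ∷ [] → z ∈ a ∷ b ∷ c ∷ [] →
                      a ∈ x ∷ y ∷ z ∷ []
    head-∈-distinct (here refl) _           _           = here refl
    head-∈-distinct (there _)   (here refl) _           = there (here refl)
    head-∈-distinct (there _)   (there _)   (here refl) = there (there (here refl))
    head-∈-distinct (there x∈)  (there y∈)  (there z∈)  = ⊥-elim (distinct-∉-pair x∈ y∈ z∈)

    distinct-cover-triple : ∀ {a b c} →
      x ∈ a ∷ b ∷ c ∷ [] → y ∈ a ∷ b ∷ c ∷ [] → z ∈ a ∷ b ∷ c ∷ [] →
      a ∈ x ∷ y ∷ z ∷ [] × b ∈ x ∷ y ∷ z ∷ [] × c ∈ x ∷ y ∷ z ∷ []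
    distinct-cover-triple x∈ y∈ z∈ =
      head-∈-distinct x∈ y∈ z∈ ,
      head-∈-distinct (rotate x∈) (rotate y∈) (rotate z∈) ,
      head-∈-distinct (rotate (rotate x∈)) (rotate (rotate y∈)) (rotate (rotate z∈))
      where
      rotate : ∀ {t a b c} → t ∈ a ∷ b ∷ c ∷ [] → t ∈ b ∷ c ∷ a ∷ []
      rotate (here e)                 = there (there (here e))
      rotate (there (here e))         = here e
      rotate (there (there (here e))) = there (here e)

module Without {A : Set} (_≟_ : DecidableEquality A) where

  infixl 5 _without_

  _≢?_ : ∀ x a → Dec (x ≢ a)
  x ≢? a = ¬? (x ≟ a)

  _without_ : List A → A → List A
  xs without a = filter (_≢? a) xs

  ∈-without⇔ : ∀ {x a xs} → x ∈ xs without a ⇔ (x ∈ xs × x ≢ a)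
  ∈-without⇔ {a = a} = mk⇔ (∈-filter⁻ (_≢? a)) (λ (x∈ , x≢a) → ∈-filter⁺ (_≢? a) x∈ x≢a)

  length-without : ∀ {a xs} → Unique xs → a ∈ xs → length xs ≡ suc (length (xs without a))
  length-without {a} (a∉xs ∷ _) (here refl) =
    cong (suc ∘ length)
      (sym (trans (filter-reject (_≢? a) (λ a≢a → a≢a refl))
                  (filter-all (_≢? a) (All.map (_∘ sym) a∉xs))))
  length-without {a} (x∉xs ∷ xs-unique) (there a∈xs) =
    cong suc (trans (length-without xs-unique a∈xs)
                    (cong length (sym (filter-accept (_≢? a) (All.lookup x∉xs a∈xs)))))

  unique-without : ∀ {a xs} → Unique xs → Unique (xs without a)
  unique-without {a} = filter⁺ (_≢? a)

module _ (G : Graph) where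
  open Graph G using (Vertex)

  ¬wins×loses : ∀ {s} → PlayerToMoveWins G s → ¬ PlayerToMoveLoses G s
  ¬wins×loses (move v L loses) (allMoves wins) = ¬wins×loses (wins v L) loses

  gp-pair : ∀ {a b} → IsGPSet G (a ∷ b ∷ [])
  gp-pair x∈ y∈ z∈ x≢y y≢z x≢z _ = distinct-∉-pair x≢y y≢z x≢z x∈ y∈ z∈

  legal-first : ∀ {v} → LegalMove G [] v
  legal-first {v} = (λ ()) , λ x∈ y∈ z∈ → gp-pair {v} (there x∈) (there y∈) (there z∈)

  legal-second : ∀ {v w} → w ≢ v → LegalMove G (v ∷ []) w
  legal-second w≢v = (λ { (here w≡v) → w≢v w≡v }) , gp-pair

  data Lasts (s : List Vertex) : ℕ → Set where
    ended     : (∀ v → ¬ LegalMove G s v) → Lasts s 0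
    continues : ∀ {r} → Σ Vertex (LegalMove G s) →
                (∀ v → LegalMove G s v → Lasts (v ∷ s) r) → Lasts s (suc r)

  lasts⇒outcome : ∀ {s r} → Lasts s r →
    (Odd r → PlayerToMoveWins G s) × (¬ Odd r → PlayerToMoveLoses G s)
  lasts⇒outcome (ended stuck) = (λ ()) , λ _ → allMoves λ v L → ⊥-elim (stuck v L)
  lasts⇒outcome {r = suc r} (continues (v , L) next) =
    (λ odd  → move v L (proj₂ (lasts⇒outcome (next v L)) (odd-suc⇒¬odd r odd))) ,
    (λ ¬odd → allMoves λ w L′ → proj₁ (lasts⇒outcome (next w L′)) (¬odd-suc⇒odd r ¬odd))

  lasts⇒wins⇔odd : ∀ {s r} → Lasts s r → PlayerToMoveWins G s ⇔ Odd r
  lasts⇒wins⇔odd {r = r} l = mk⇔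
    (λ wins → decidable-stable (Odd? r) λ ¬odd → ¬wins×loses wins (proj₂ (lasts⇒outcome l) ¬odd))
    (proj₁ (lasts⇒outcome l))

-- Legal moves carry tokens and a move x uses up exactly the moves carrying tok x, so the
-- game lasts as many moves as there are distinct available tokens.
module Countdown (G : Graph) {T : Set} (_≟_ : DecidableEquality T)
  (tok : Graph.Vertex G → T) (realise : T → Graph.Vertex G) (tok∘realise : ∀ t → tok (realise t) ≡ t)
  (Inv : List (Graph.Vertex G) → Set)
  (inv-step : ∀ {s x} → Inv s → LegalMove G s x → Inv (x ∷ s))
  (legal-step : ∀ {s x y} → Inv s → LegalMove G s x →
                LegalMove G (x ∷ s) y ⇔ (LegalMove G s y × tok y ≢ tok x))
  where

  open Without _≟_

  lasts : ∀ {r s} (R : List T) → length R ≡ r → Unique R → Inv s →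
          (∀ y → LegalMove G s y ⇔ tok y ∈ R) → Lasts G s r
  lasts {zero}  []      _  _ _ legal = ended λ y L → ¬Any[] (to (legal y) L)
  lasts {zero}  (_ ∷ _) ()
  lasts {suc _} []      ()
  lasts {suc r} R@(t ∷ _) |R| R-unique inv legal = continues
    (realise t , from (legal _) (subst (_∈ R) (sym (tok∘realise t)) (here refl)))
    λ x L → lasts (R without tok x)
      (suc-injective (trans (sym (length-without R-unique (to (legal x) L))) |R|))
      (unique-without R-unique) (inv-step inv L)
      λ y → ⇔-trans (legal-step inv L) (⇔-trans (legal y ×-⇔ ⇔-refl) (⇔-sym (∈-without⇔)))

  lasts-after-two : ∀ {v w} (U : List T) → Unique U → tok v ∈ U → tok w ∈ U → tok w ≢ tok v →
    Inv (w ∷ v ∷ []) → (∀ y → LegalMove G (w ∷ v ∷ []) y ⇔ (tok y ∈ U × tok y ∉ tok w ∷ tok v ∷ [])) →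
    Lasts G (w ∷ v ∷ []) (length U ∸ 2)
  lasts-after-two {v} {w} U U-unique v∈U w∈U w≢v inv legal =
    lasts R (cong (_∸ 2) (sym |U|)) (unique-without (unique-without U-unique)) inv
      λ y → ⇔-trans (legal y) (mk⇔ (into y) (outof y))
    where
    R = U without tok v without tok w
    |U| : length U ≡ suc (suc (length R))
    |U| = trans (length-without U-unique v∈U)
                (cong suc (length-without (unique-without U-unique)
                                              (from (∈-without⇔) (w∈U , w≢v))))
    into : ∀ y → tok y ∈ U × tok y ∉ tok w ∷ tok v ∷ [] → tok y ∈ R
    into y (y∈U , y∉) = from (∈-without⇔) (from (∈-without⇔) (y∈U , y∉ ∘ there ∘ here) , y∉ ∘ here)
    outof : ∀ y → tok y ∈ R → tok y ∈ U × tok y ∉ tok w ∷ tok v ∷ []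
    outof y y∈R with to (∈-without⇔) y∈R
    ... | y∈ , y≢w with to (∈-without⇔) y∈
    ... | y∈U , y≢v = y∈U , λ { (here e) → y≢w e ; (there (here e)) → y≢v e }

module CompleteMultipartite {k : ℕ} {n : Fin k → ℕ} (2≤k : 2 ≤ k) (2≤n : ∀ i → 2 ≤ n i) where

  K : Graph
  K = completeMultipartite k n

  open Graph K using (Vertex)

  part : Vertex → Fin k
  part = proj₁

  _≟ᵛ_ : DecidableEquality Vertex
  _≟ᵛ_ = ≡-dec _≟ᶠ_ _≟ᶠ_

  vertexIn : Fin k → Vertex
  vertexIn i = i , inhabitant (2≤n i)

  walk-of-length≤2 : ∀ u v → Σ (Walk K u v) λ p → walkLength K p ≤ 2
  walk-of-length≤2 u v with part u ≟ᶠ part v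
  ... | no pu≢pv = step pu≢pv (here v) , s≤s z≤n
  ... | yes pu≡pv =
    step {w = vertexIn j} (j≢pu ∘ sym) (step (λ j≡pv → j≢pu (trans j≡pv (sym pu≡pv))) (here v)) ,
    s≤s (s≤s z≤n)
    where
    j = proj₁ (another 2≤k (part u))
    j≢pu = proj₂ (another 2≤k (part u))

  shortest⇒length≤2 : ∀ {u v} (p : Walk K u v) → IsShortest K p → walkLength K p ≤ 2
  shortest⇒length≤2 {u} {v} p shortest = let q , |q|≤2 = walk-of-length≤2 u v in
    ≤-trans (shortest q) |q|≤2

  SharesPart : List Vertex → Set
  SharesPart S = ∃[ a ] ∃[ b ] a ∈ S × b ∈ S × a ≢ b × part a ≡ part b

  SpansParts : List Vertex → Set
  SpansParts S = ∃[ a ] ∃[ b ] a ∈ S × b ∈ S × part a ≢ part b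

  PartInjective : List Vertex → Set
  PartInjective S = ∀ {a b} → a ∈ S → b ∈ S → part a ≡ part b → a ≡ b

  -- A geodesic through three vertices is u – w – v with u, v distinct in one part.
  geodesic⇒mixed : ∀ {S x y z} → x ∈ S → y ∈ S → z ∈ S → x ≢ y → y ≢ z → x ≢ z →
    OnCommonShortestPath K x y z → SharesPart S × SpansParts S
  geodesic⇒mixed {S} {x} {y} {z} x∈S y∈S z∈S x≢y y≢z x≢z (_ , _ , p , shortest , x∈p , y∈p , z∈p) =
    along p shortest (shortest⇒length≤2 p shortest) x∈p y∈p z∈p
    where
    ∈S : ∀ {t} → t ∈ x ∷ y ∷ z ∷ [] → t ∈ S
    ∈S (here refl)                 = x∈S
    ∈S (there (here refl))         = y∈S
    ∈S (there (there (here refl))) = z∈S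

    along : ∀ {u v} (p : Walk K u v) → IsShortest K p → walkLength K p ≤ 2 →
      x ∈ walkVertices K p → y ∈ walkVertices K p → z ∈ walkVertices K p → SharesPart S × SpansParts S
    along (here u) _ _ x∈ y∈ z∈ =
      ⊥-elim (distinct-∉-pair x≢y y≢z x≢z {u} (there x∈) (there y∈) (there z∈))
    along (step _ (here _)) _ _ x∈ y∈ z∈ = ⊥-elim (distinct-∉-pair x≢y y≢z x≢z x∈ y∈ z∈)
    along {u} {v} (step {w = w} pu≢pw (step _ (here _))) shortest _ x∈ y∈ z∈ =
      (u , v , ∈S u∈ , ∈S v∈ , u≢v , pu≡pv) , (u , w , ∈S u∈ , ∈S w∈ , pu≢pw)
      where
      covers = distinct-cover-triple x≢y y≢z x≢z x∈ y∈ z∈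
      u∈ = proj₁ covers
      w∈ = proj₁ (proj₂ covers)
      v∈ = proj₂ (proj₂ covers)
      pu≡pv : part u ≡ part v
      pu≡pv = decidable-stable (part u ≟ᶠ part v) λ pu≢pv → 1+n≰n (shortest (step pu≢pv (here v)))
      u≢v : u ≢ v
      u≢v refl = n≮0 (shortest (here u))
    along (step _ (step _ (step _ _))) _ (s≤s (s≤s ()))

  geodesic-via-other-part : ∀ {x y z} → x ≢ y → part x ≡ part y → part z ≢ part x →
    OnCommonShortestPath K x y z
  geodesic-via-other-part {x} {y} {z} x≢y px≡py pz≢px =
    x , y , step (pz≢px ∘ sym) (step (λ pz≡py → pz≢px (trans pz≡py (sym px≡py))) (here y)) ,
    length≥2 , here refl , there (there (here refl)) , there (here refl)
    where
    length≥2 : (q : Walk K x y) → 2 ≤ walkLength K q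
    length≥2 (here _)                = ⊥-elim (x≢y refl)
    length≥2 (step px≢py (here _))   = ⊥-elim (px≢py px≡py)
    length≥2 (step _ (step _ _))     = s≤s (s≤s z≤n)

  one-part⇒gp : ∀ {S i} → (∀ {v} → v ∈ S → part v ≡ i) → IsGPSet K S
  one-part⇒gp in-i x∈ y∈ z∈ x≢y y≢z x≢z geodesic
    with a , b , a∈ , b∈ , pa≢pb ← proj₂ (geodesic⇒mixed x∈ y∈ z∈ x≢y y≢z x≢z geodesic)
    = pa≢pb (trans (in-i a∈) (sym (in-i b∈)))

  part-injective⇒gp : ∀ {S} → PartInjective S → IsGPSet K S
  part-injective⇒gp inj x∈ y∈ z∈ x≢y y≢z x≢z geodesic
    with a , b , a∈ , b∈ , a≢b , pa≡pb ← proj₁ (geodesic⇒mixed x∈ y∈ z∈ x≢y y≢z x≢z geodesic)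
    = a≢b (inj a∈ b∈ pa≡pb)

  module InPart (i : Fin k) where

    Inv : List Vertex → Set
    Inv s = (∀ {v} → v ∈ s → part v ≡ i) × SharesPart s

    legal⇔ : ∀ {s y} → Inv s → LegalMove K s y ⇔ (part y ≡ i × y ∉ s)
    legal⇔ {s} {y} (in-i , a , b , a∈ , b∈ , a≢b , _) = mk⇔
      (λ (y∉s , gp) → decidable-stable (part y ≟ᶠ i) (λ py≢i →
         gp (there a∈) (there b∈) (here refl) a≢b (λ { refl → y∉s b∈ }) (λ { refl → y∉s a∈ })
            (geodesic-via-other-part a≢b (trans (in-i a∈) (sym (in-i b∈)))
                                         (λ py≡pa → py≢i (trans py≡pa (in-i a∈))))) ,
         y∉s)
      (λ (py≡i , y∉s) → y∉s , one-part⇒gp λ { (here refl) → py≡i ; (there v∈) → in-i v∈ })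

    inv-step : ∀ {s x} → Inv s → LegalMove K s x → Inv (x ∷ s)
    inv-step inv@(in-i , a , b , a∈ , b∈ , shared) L =
      (λ { (here refl) → proj₁ (to (legal⇔ inv) L) ; (there v∈) → in-i v∈ }) ,
      a , b , there a∈ , there b∈ , shared

    legal-step : ∀ {s x y} → Inv s → LegalMove K s x → LegalMove K (x ∷ s) y ⇔ (LegalMove K s y × y ≢ x)
    legal-step inv L = ⇔-trans (legal⇔ (inv-step inv L)) (mk⇔
      (λ (py≡i , y∉) → let y∉s , y≢x = to ∉-∷⇔ y∉ in from (legal⇔ inv) (py≡i , y∉s) , y≢x)
      (λ (L′ , y≢x) → let py≡i , y∉s = to (legal⇔ inv) L′ in py≡i , from ∉-∷⇔ (y∉s , y≢x)))

    open Countdown K _≟ᵛ_ id id (λ _ → refl) Inv inv-step legal-step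

    vertexAt : Fin (n i) → Vertex
    vertexAt j = i , j

    vertices : List Vertex
    vertices = map vertexAt (allFin (n i))

    ∈-vertices⇔ : ∀ {y} → y ∈ vertices ⇔ part y ≡ i
    ∈-vertices⇔ = mk⇔ (λ y∈ → let _ , _ , y≡ = ∈-map⁻ vertexAt y∈ in cong part y≡)
                      (λ { refl → ∈-map⁺ vertexAt (∈-allFin _) })

    lasts-in-part : ∀ {v w} → part v ≡ i → part w ≡ i → w ≢ v → Lasts K (w ∷ v ∷ []) (n i ∸ 2)
    lasts-in-part {v} {w} pv≡i pw≡i w≢v =
      subst (λ m → Lasts K (w ∷ v ∷ []) (m ∸ 2))
            (trans (length-map vertexAt (allFin (n i))) (length-allFin (n i)))
        (lasts-after-two vertices (map⁺ vertexAt-injective (allFin⁺ (n i)))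
          (from ∈-vertices⇔ pv≡i) (from ∈-vertices⇔ pw≡i) w≢v inv
          λ y → ⇔-trans (legal⇔ inv) (⇔-sym ∈-vertices⇔ ×-⇔ ⇔-refl))
      where
      vertexAt-injective : ∀ {a b} → vertexAt a ≡ vertexAt b → a ≡ b
      vertexAt-injective refl = refl
      inv : Inv (w ∷ v ∷ [])
      inv = (λ { (here refl) → pw≡i ; (there (here refl)) → pv≡i }) ,
            w , v , here refl , there (here refl) , w≢v , trans pw≡i (sym pv≡i)

  module AcrossParts where

    Inv : List Vertex → Set
    Inv s = PartInjective s × SpansParts s

    part-injective-∷ : ∀ {s y} → PartInjective s → part y ∉ map part s → PartInjective (y ∷ s)
    part-injective-∷ inj py∉ (here refl) (here refl) _     = refl
    part-injective-∷ inj py∉ (here refl) (there b∈)  py≡pb =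
      ⊥-elim (py∉ (subst (_∈ _) (sym py≡pb) (∈-map⁺ part b∈)))
    part-injective-∷ inj py∉ (there a∈)  (here refl) pa≡py =
      ⊥-elim (py∉ (subst (_∈ _) pa≡py (∈-map⁺ part a∈)))
    part-injective-∷ inj py∉ (there a∈)  (there b∈)  pa≡pb = inj a∈ b∈ pa≡pb

    legal⇔ : ∀ {s y} → Inv s → LegalMove K s y ⇔ part y ∉ map part s
    legal⇔ {s} {y} (inj , spans) = mk⇔ new-part legal
      where
      other-part : SpansParts s → ∃[ z ] z ∈ s × part z ≢ part y
      other-part (a , b , a∈ , b∈ , pa≢pb) with part a ≟ᶠ part y
      ... | no pa≢py  = a , a∈ , pa≢py
      ... | yes pa≡py = b , b∈ , λ pb≡py → pa≢pb (trans pa≡py (sym pb≡py))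

      new-part : LegalMove K s y → part y ∉ map part s
      new-part (y∉s , gp) py∈ with ∈-map⁻ part py∈ | other-part spans
      ... | v , v∈ , py≡pv | z , z∈ , pz≢py =
        gp (there v∈) (here refl) (there z∈) v≢y (λ { refl → pz≢py refl })
           (λ { refl → pz≢py (sym py≡pv) })
           (geodesic-via-other-part v≢y (sym py≡pv) (λ pz≡pv → pz≢py (trans pz≡pv (sym py≡pv))))
        where
        v≢y : v ≢ y
        v≢y refl = y∉s v∈

      legal : part y ∉ map part s → LegalMove K s y
      legal py∉ = py∉ ∘ ∈-map⁺ part , part-injective⇒gp (part-injective-∷ inj py∉)

    inv-step : ∀ {s x} → Inv s → LegalMove K s x → Inv (x ∷ s)
    inv-step inv@(inj , a , b , a∈ , b∈ , pa≢pb) L =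
      part-injective-∷ inj (to (legal⇔ inv) L) , a , b , there a∈ , there b∈ , pa≢pb

    legal-step : ∀ {s x y} → Inv s → LegalMove K s x →
                 LegalMove K (x ∷ s) y ⇔ (LegalMove K s y × part y ≢ part x)
    legal-step inv L =
      ⇔-trans (legal⇔ (inv-step inv L)) (⇔-trans ∉-∷⇔ (⇔-sym (legal⇔ inv) ×-⇔ ⇔-refl))

    open Countdown K _≟ᶠ_ part vertexIn (λ _ → refl) Inv inv-step legal-step

    lasts-across-parts : ∀ {v w} → part w ≢ part v → Lasts K (w ∷ v ∷ []) (k ∸ 2)
    lasts-across-parts {v} {w} pw≢pv =
      subst (λ m → Lasts K (w ∷ v ∷ []) (m ∸ 2)) (length-allFin k)
        (lasts-after-two (allFin k) (allFin⁺ k) (∈-allFin _) (∈-allFin _) pw≢pv inv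
          λ y → ⇔-trans (legal⇔ inv) (mk⇔ (∈-allFin _ ,_) proj₂))
      where
      inv : Inv (w ∷ v ∷ [])
      inv = part-injective-∷ (λ { (here refl) (here refl) _ → refl })
                             (λ { (here pw≡pv) → pw≢pv pw≡pv }) ,
            w , v , here refl , there (here refl) , pw≢pv

  reply-in-part : ∀ {v w} → w ≢ v → part w ≡ part v → PlayerToMoveWins K (w ∷ v ∷ []) ⇔ Odd (n (part v))
  reply-in-part {v} w≢v pw≡pv =
    ⇔-trans (lasts⇒wins⇔odd K (InPart.lasts-in-part (part v) refl pw≡pv w≢v)) (odd-∸2⇔odd (2≤n (part v)))

  reply-across-parts : ∀ {v w} → part w ≢ part v → PlayerToMoveWins K (w ∷ v ∷ []) ⇔ Odd k
  reply-across-parts pw≢pv =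
    ⇔-trans (lasts⇒wins⇔odd K (AcrossParts.lasts-across-parts pw≢pv)) (odd-∸2⇔odd 2≤k)

  a-wins⇒odd : AWinsGP K → Odd k × Σ (Fin k) (λ i → Odd (n i))
  a-wins⇒odd (move (i , j) _ (allMoves reply))
    with i′ , i′≢i ← another 2≤k i | j′ , j′≢j ← another (2≤n i) j =
    to (reply-across-parts i′≢i) (reply (vertexIn i′) (legal-second K (i′≢i ∘ cong part))) ,
    i , to (reply-in-part w≢v refl) (reply (i , j′) (legal-second K w≢v))
    where
    w≢v : (i , j′) ≢ (i , j)
    w≢v refl = j′≢j refl

  odd⇒a-wins : Odd k × Σ (Fin k) (λ i → Odd (n i)) → AWinsGP K
  odd⇒a-wins (odd-k , i , odd-nᵢ) = move (vertexIn i) (legal-first K) (allMoves reply)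
    where
    reply : ∀ w → LegalMove K (vertexIn i ∷ []) w → PlayerToMoveWins K (w ∷ vertexIn i ∷ [])
    reply w (w∉ , _) with part w ≟ᶠ i
    ... | yes pw≡i = from (reply-in-part (w∉ ∘ here) pw≡i) odd-nᵢ
    ... | no pw≢i  = from (reply-across-parts pw≢i) odd-k

proposition2p3 : (k : ℕ) (n : Fin k → ℕ) → 2 ≤ k → ((i : Fin k) → 2 ≤ n i) →
    (AWinsGP (completeMultipartite k n) ⇔ (Odd k × Σ (Fin k) (λ i → Odd (n i))))
proposition2p3 k n 2≤k 2≤n = mk⇔ a-wins⇒odd odd⇒a-wins
  where open CompleteMultipartite 2≤k 2≤n
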